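{- For every positive integer $n$, the list packing number of the complete graph $K_n$ satisfies $\chi_{\ell}^*(K_n) = n$.
   Context: All graphs are finite and simple. A list assignment $L$ for a graph $G$ assigns to each vertex $v \in V(G)$ a set $L(v)$ of colors; $L$ is a $k$-assignment if $|L(v)| = k$ for every $v \in V(G)$. An $L$-coloring of $G$ is a function $f$ on $V(G)$ with $f(v) \in L(v)$ for all $v$; it is proper if $f(u) \neq f(v)$ whenever $uv \in E(G)$. An $L$-packing of $G$ of size $k$ is a set of $k$ $L$-colorings $\{f_1, \ldots, f_k\}$ of $G$ such that $f_i(v) \neq f_j(v)$ whenever $i \neq j$ and $v \in V(G)$; it is proper if each $f_i$ is a proper $L$-coloring. The list packing number $\chi_{\ell}^*(G)$ is the least $k$ such that $G$ has a proper $L$-packing of size $k$ for every $k$-assignment $L$ for $G$. -}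

module Defs where

open import Data.Nat using (ℕ; _≤_; _<_; suc)
open import Data.Fin using (Fin)
open import Data.List using (List; length)
open import Data.List.Membership.Propositional using (_∈_)
open import Data.List.Relation.Unary.Unique.Propositional using (Unique)
open import Data.Product using (Σ; _×_)
open import Relation.Binary.PropositionalEquality using (_≡_; _≢_)
open import Relation.Nullary using (¬_)

record Graph (n : ℕ) : Set₁ where
  field
    Adj   : Fin n → Fin n → Set
    sym   : ∀ {u v} → Adj u v → Adj v u
    irrefl : ∀ {v} → ¬ Adj v v
open Graph public

K : (n : ℕ) → Graph n
K n = record { Adj = λ u v → u ≢ v ; sym = λ p q → p (Relation.Binary.PropositionalEquality.sym q)
             ; irrefl = λ p → p Relation.Binary.PropositionalEquality.refl }

-- Colours are natural numbers; a list assignment gives each vertex a finite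
-- set of colours, represented as a duplicate-free list.
ListAssignment : ℕ → Set
ListAssignment n = Fin n → List ℕ

IsKAssignment : ∀ {n} → ℕ → ListAssignment n → Set
IsKAssignment {n} k L = (v : Fin n) → Unique (L v) × length (L v) ≡ k

IsLColoring : ∀ {n} → ListAssignment n → (Fin n → ℕ) → Set
IsLColoring {n} L f = (v : Fin n) → f v ∈ L v

IsProper : ∀ {n} → Graph n → (Fin n → ℕ) → Set
IsProper {n} G f = ∀ (u v : Fin n) → Adj G u v → f u ≢ f v

IsProperLPacking : ∀ {n} → Graph n → ListAssignment n → (k : ℕ) → (Fin k → Fin n → ℕ) → Set
IsProperLPacking {n} G L k f =
  ((i : Fin k) → IsLColoring L (f i) × IsProper G (f i)) ×
  ((i j : Fin k) → i ≢ j → (v : Fin n) → f i v ≢ f j v)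

PackingProperty : ∀ {n} → Graph n → ℕ → Set
PackingProperty {n} G k =
  (L : ListAssignment n) → IsKAssignment k L → Σ (Fin k → Fin n → ℕ) (IsProperLPacking G L k)

ListPackingNumber≡ : ∀ {n} → Graph n → ℕ → Set
ListPackingNumber≡ G k =
  1 ≤ k × PackingProperty G k × (∀ j → 1 ≤ j → PackingProperty G j → k ≤ j)

-- Lower bound: if every list is {0, …, j − 1}, one proper colouring of K_n is an
-- injection of the n vertices into j colours, so n ≤ j.
-- Upper bound (König's edge-colouring argument): a proper L-packing of K_n of size n
-- is an n × n array whose row v takes values in L(v), with distinct entries in every
-- row and every column. Fill it one empty cell (v, α) at a time. By counting, some
-- s ∈ L(v) is missing from row v and some column β is missing s. If s occurs in
-- column α, exchange the entries of columns α and β on the rows of the Kempe chain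
-- that starts at the row holding s in column α and alternates between the two
-- columns. Being closed under the alternation, the chain can be swapped without
-- breaking injectivity; it never reaches row v (whose α-cell is empty), and the swap
-- clears s from column α. Then put s into (v, α).
module Submission where

open import Data.Fin using (Fin; zero; suc; punchIn; punchOut; fromℕ<; toℕ) renaming (_≟_ to _≟ᶠ_)
open import Data.Fin.Permutation using (Permutation; _⟨$⟩ʳ_; transpose) renaming (id to idₚ)
import Data.Fin.Permutation.Components as PC
open import Data.Fin.Properties
  using (any?; all?; ¬∀⟶∃¬; injective⇒≤; punchOut-injective; punchInᵢ≢i; toℕ-fromℕ<)
open import Data.Fin.Subset using (Subset; _∈_; _∉_; _⊂_; _⊃_; _∪_; ⁅_⁆) renaming (⊥ to ∅)
open import Data.Fin.Subset.Induction using (⊃-wellFounded)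
open import Data.Fin.Subset.Properties using (_∈?_; ∉⊥; x∈⁅x⁆; x∈⁅y⁆⇒x≡y; x∈p∪q⁻; x∈p∪q⁺; p⊆p∪q)
open import Data.List using (List; length; lookup; upTo)
open import Data.List.Membership.Propositional using () renaming (_∈_ to _∈ˡ_)
open import Data.List.Membership.Propositional.Properties using (∈-lookup; ∈-upTo⁻)
open import Data.List.Properties using (length-upTo)
import Data.List.Relation.Unary.All as All
open import Data.List.Relation.Unary.AllPairs using (_∷_)
open import Data.List.Relation.Unary.Unique.Propositional using (Unique)
open import Data.List.Relation.Unary.Unique.Propositional.Properties using (upTo⁺)
open import Data.Maybe using (Maybe; just; nothing)
open import Data.Maybe.Properties using (just-injective) renaming (≡-dec to ≡-decₘ)
open import Data.Nat using (ℕ; zero; suc; _+_; _≤_; _<_; s≤s) renaming (_≟_ to _≟ℕ_)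
open import Data.Nat.Induction using (<-wellFounded)
open import Data.Nat.Properties using (≤-refl; ≤-reflexive; <⇒≱; +-0-commutativeMonoid)
open import Algebra.Properties.CommutativeMonoid.Sum +-0-commutativeMonoid
  using (sum; sum-cong-≗; sum-remove; sum-permute)
open import Data.Product using (∃; _×_; _,_; proj₁; proj₂)
open import Data.Sum using (_⊎_; inj₁; inj₂)
import Data.Sum as Sum
open import Function using (_∘_; case_of_)
open import Function.Bundles using (Injection)
open import Function.Definitions using (Injective)
open import Function.Properties.Inverse using (↔⇒↣)
open import Induction.WellFounded using (Acc; acc)
open import Relation.Binary.Definitions using (DecidableEquality)
open import Relation.Binary.PropositionalEquality
open import Relation.Nullary using (¬_; Dec; yes; no; contradiction)

open import Defs
  using (K; IsProper; PackingProperty; ListPackingNumber≡)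

sum-suc-at : ∀ {m} (f g : Fin m → ℕ) (j : Fin m) → f j ≡ suc (g j) →
             (∀ k → k ≢ j → f k ≡ g k) → sum f ≡ suc (sum g)
sum-suc-at {zero}  f g () _ _
sum-suc-at {suc m} f g j fj≡ elsewhere = begin
  sum f                                    ≡⟨ sum-remove {i = j} f ⟩
  f j + sum (λ k → f (punchIn j k))        ≡⟨ cong₂ _+_ fj≡ (sum-cong-≗ λ k → elsewhere _ (punchInᵢ≢i j k)) ⟩
  suc (g j + sum (λ k → g (punchIn j k)))  ≡⟨ cong suc (sum-remove {i = j} g) ⟨
  suc (sum g)                              ∎
  where open ≡-Reasoning

injective-missing⇒< : ∀ {m n} (f : Fin m → Fin n) → Injective _≡_ _≡_ f →
                      (c : Fin n) → (∀ i → f i ≢ c) → m < n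
injective-missing⇒< {n = zero}  f f-injective () f-misses
injective-missing⇒< {n = suc n} f f-injective c  f-misses = s≤s (injective⇒≤ g-injective)
  where
  g-injective : Injective _≡_ _≡_ (λ i → punchOut (f-misses i ∘ sym))
  g-injective {i} {j} = f-injective ∘ punchOut-injective (f-misses i ∘ sym) (f-misses j ∘ sym)

∃-unmatched : ∀ {m n} {R : Fin m → Fin n → Set} → (∀ i j → Dec (R i j)) →
              (∀ {i i' j} → R i j → R i' j → i ≡ i') →
              (c : Fin n) → (∀ i → ¬ R i c) → n ≤ m → ∃ λ i → ∀ j → ¬ R i j
∃-unmatched {m} {n} {R} R? R-injective c c-unmatched n≤m with all? (λ i → any? (R? i))
... | yes matched = contradiction n≤m (<⇒≱ (injective-missing⇒< match match-injective c match-misses))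
  where
  match : Fin m → Fin n
  match i = proj₁ (matched i)
  match-injective : Injective _≡_ _≡_ match
  match-injective {i} {i'} e = R-injective (proj₂ (matched i)) (subst (R i') (sym e) (proj₂ (matched i')))
  match-misses : ∀ i → match i ≢ c
  match-misses i e = c-unmatched i (subst (R i) e (proj₂ (matched i)))
... | no ¬matched with ¬∀⟶∃¬ m _ (λ i → any? (R? i)) ¬matched
...   | i , unmatched = i , λ j Rij → unmatched (j , Rij)

lookup-injective : ∀ {A : Set} {xs : List A} → Unique xs → Injective _≡_ _≡_ (lookup xs)
lookup-injective (x∉xs ∷ _)   {zero}  {zero}  _ = refl
lookup-injective (x∉xs ∷ _)   {zero}  {suc j} e = contradiction e (All.lookup x∉xs (∈-lookup j))
lookup-injective (x∉xs ∷ _)   {suc i} {zero}  e = contradiction (sym e) (All.lookup x∉xs (∈-lookup i))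
lookup-injective (_    ∷ xs!) {suc i} {suc j} e = cong suc (lookup-injective xs! e)

transpose-matchˡ : ∀ {n} {i j k : Fin n} → k ≡ i → PC.transpose i j k ≡ j
transpose-matchˡ {i = i} refl with i ≟ᶠ i
... | yes _  = refl
... | no i≢i = contradiction refl i≢i

transpose-matchʳ : ∀ {n} {i j k : Fin n} → k ≡ j → PC.transpose i j k ≡ i
transpose-matchʳ {i = i} {j} refl with j ≟ᶠ i
... | yes refl = refl
... | no _ with j ≟ᶠ j
...   | yes _  = refl
...   | no j≢j = contradiction refl j≢j

transpose-others : ∀ {n} {i j k : Fin n} → k ≢ i → k ≢ j → PC.transpose i j k ≡ k
transpose-others {i = i} {j} {k} k≢i k≢j with k ≟ᶠ i
... | yes k≡i = contradiction k≡i k≢i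
... | no _ with k ≟ᶠ j
...   | yes k≡j = contradiction k≡j k≢j
...   | no _    = refl

permutation-injective : ∀ {n} (π : Permutation n n) → Injective _≡_ _≡_ (π ⟨$⟩ʳ_)
permutation-injective π = Injection.injective (↔⇒↣ π)

∈-∪⁅⁆⁻ : ∀ {r} {W : Subset r} {w x} → w ∈ W ∪ ⁅ x ⁆ → w ∈ W ⊎ w ≡ x
∈-∪⁅⁆⁻ {W = W} {x = x} = Sum.map₂ (x∈⁅y⁆⇒x≡y x) ∘ x∈p∪q⁻ W ⁅ x ⁆

∈-∪⁅⁆ˡ : ∀ {r} {W : Subset r} {w} x → w ∈ W → w ∈ W ∪ ⁅ x ⁆
∈-∪⁅⁆ˡ x = p⊆p∪q ⁅ x ⁆

∈-∪⁅⁆ʳ : ∀ {r} {W : Subset r} x → x ∈ W ∪ ⁅ x ⁆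
∈-∪⁅⁆ʳ x = x∈p∪q⁺ (inj₂ (x∈⁅x⁆ x))

⊂-∪⁅⁆ : ∀ {r} {W : Subset r} {x} → x ∉ W → W ⊂ W ∪ ⁅ x ⁆
⊂-∪⁅⁆ {x = x} x∉W = ∈-∪⁅⁆ˡ x , x , ∈-∪⁅⁆ʳ x , x∉W

-- Exchanging the entries of a and b on the rows of W keeps both columns injective.
KempeClosed : ∀ {A : Set} {r} (a b : Fin r → Maybe A) → Subset r → Set
KempeClosed a b W = ∀ {w w' x} → w ∈ W →
  (b w ≡ just x → a w' ≡ just x → w' ∈ W) × (a w ≡ just x → b w' ≡ just x → w' ∈ W)

module KempeChain {A : Set} (_≟_ : DecidableEquality A) {r : ℕ} (a b : Fin r → Maybe A)
  (a-injective : ∀ {w w' x} → a w ≡ just x → a w' ≡ just x → w ≡ w')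
  (b-injective : ∀ {w w' x} → b w ≡ just x → b w' ≡ just x → w ≡ w')
  (a≢b : ∀ {w x} → a w ≡ just x → b w ≢ just x)
  {s : A} (s∉b : ∀ w → b w ≢ just s)
  {v r₁ : Fin r} (a-v : a v ≡ nothing) (a-r₁ : a r₁ ≡ just s) where

  -- W is the alternating path r₁, …, c (the a-entry of each row is the b-entry of
  -- the previous one); by fresh, continuing it past c reaches a row outside W.
  record Chain (W : Subset r) (c : Fin r) : Set where
    field
      v∉W      : v ∉ W
      r₁∈W     : r₁ ∈ W
      c∈W      : c ∈ W
      forward  : ∀ {w w' x} → w ∈ W → w ≢ c → b w ≡ just x → a w' ≡ just x → w' ∈ W
      backward : ∀ {w w' x} → w ∈ W → a w ≡ just x → b w' ≡ just x → w' ∈ W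
      fresh    : ∀ {w x} → w ∈ W → b c ≡ just x → a w ≢ just x
  open Chain

  start : Chain ⁅ r₁ ⁆ r₁
  start = record
    { v∉W      = v≢r₁ ∘ x∈⁅y⁆⇒x≡y r₁
    ; r₁∈W     = x∈⁅x⁆ r₁
    ; c∈W      = x∈⁅x⁆ r₁
    ; forward  = λ w∈ w≢r₁ _ _ → contradiction (x∈⁅y⁆⇒x≡y r₁ w∈) w≢r₁
    ; backward = λ { w∈ a-w b-w' → backward-r₁ (x∈⁅y⁆⇒x≡y r₁ w∈) a-w b-w' }
    ; fresh    = λ { w∈ b-r₁ a-w → fresh-r₁ (x∈⁅y⁆⇒x≡y r₁ w∈) b-r₁ a-w }
    }
    where
    v≢r₁ : v ≢ r₁
    v≢r₁ refl = case trans (sym a-v) a-r₁ of λ ()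
    backward-r₁ : ∀ {w w' x} → w ≡ r₁ → a w ≡ just x → b w' ≡ just x → w' ∈ ⁅ r₁ ⁆
    backward-r₁ refl a-w b-w' = contradiction (trans b-w' (trans (sym a-w) a-r₁)) (s∉b _)
    fresh-r₁ : ∀ {w x} → w ≡ r₁ → b r₁ ≡ just x → a w ≢ just x
    fresh-r₁ refl b-r₁ a-w = a≢b a-w b-r₁

  extend : ∀ {W c t r'} → Chain W c → b c ≡ just t → a r' ≡ just t → Chain (W ∪ ⁅ r' ⁆) r'
  extend {W} {c} {t} {r'} ch b-c a-r' = record
    { v∉W      = λ v∈ → v∉W' (∈-∪⁅⁆⁻ v∈)
    ; r₁∈W     = ∈-∪⁅⁆ˡ r' (r₁∈W ch)
    ; c∈W      = ∈-∪⁅⁆ʳ r'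
    ; forward  = λ w∈ → forward' (∈-∪⁅⁆⁻ w∈)
    ; backward = λ w∈ → backward' (∈-∪⁅⁆⁻ w∈)
    ; fresh    = λ w∈ → fresh' (∈-∪⁅⁆⁻ w∈)
    }
    where
    r'∉W : r' ∉ W
    r'∉W r'∈W = fresh ch r'∈W b-c a-r'
    v∉W' : ¬ (v ∈ W ⊎ v ≡ r')
    v∉W' (inj₁ v∈W)  = v∉W ch v∈W
    v∉W' (inj₂ refl) = case trans (sym a-v) a-r' of λ ()
    forward' : ∀ {w w' x} → w ∈ W ⊎ w ≡ r' → w ≢ r' → b w ≡ just x → a w' ≡ just x → w' ∈ W ∪ ⁅ r' ⁆
    forward' (inj₂ w≡r') w≢r' _ _ = contradiction w≡r' w≢r'
    forward' {w} (inj₁ w∈W) _ b-w a-w' with w ≟ᶠ c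
    ... | yes refl = subst (_∈ W ∪ ⁅ r' ⁆) (a-injective (trans (trans a-r' (sym b-c)) b-w) a-w') (∈-∪⁅⁆ʳ r')
    ... | no w≢c   = ∈-∪⁅⁆ˡ r' (forward ch w∈W w≢c b-w a-w')
    backward' : ∀ {w w' x} → w ∈ W ⊎ w ≡ r' → a w ≡ just x → b w' ≡ just x → w' ∈ W ∪ ⁅ r' ⁆
    backward' (inj₁ w∈W) a-w b-w' = ∈-∪⁅⁆ˡ r' (backward ch w∈W a-w b-w')
    backward' (inj₂ refl) a-w b-w' =
      ∈-∪⁅⁆ˡ r' (subst (_∈ W) (b-injective (trans (trans b-c (sym a-r')) a-w) b-w') (c∈W ch))
    fresh' : ∀ {w x} → w ∈ W ⊎ w ≡ r' → b r' ≡ just x → a w ≢ just x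
    fresh' (inj₁ w∈W) b-r' a-w = r'∉W (backward ch w∈W a-w b-r')
    fresh' (inj₂ refl) b-r' a-w = a≢b a-w b-r'

  close : ∀ {W c} → Chain W c → (∀ {w x} → b c ≡ just x → a w ≢ just x) → KempeClosed a b W
  close {W} {c} ch dead {w} w∈W = forward-at-c , backward ch w∈W
    where
    forward-at-c : ∀ {w' x} → b w ≡ just x → a w' ≡ just x → w' ∈ W
    forward-at-c b-w a-w' with w ≟ᶠ c
    ... | yes refl = contradiction a-w' (dead b-w)
    ... | no w≢c   = forward ch w∈W w≢c b-w a-w'

  grow : ∀ {W c} → Chain W c → Acc _⊃_ W → ∃ λ W → v ∉ W × r₁ ∈ W × KempeClosed a b W
  grow {W} {c} ch (acc larger) with b c in b-c
  ... | nothing = W , v∉W ch , r₁∈W ch , close ch λ b-c' _ → case trans (sym b-c) b-c' of λ ()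
  ... | just t with any? (λ w → ≡-decₘ _≟_ (a w) (just t))
  ...   | no none = W , v∉W ch , r₁∈W ch , close ch λ b-c' a-w → none (_ , trans a-w (trans (sym b-c') b-c))
  ...   | yes (r' , a-r') = grow (extend ch b-c a-r') (larger (⊂-∪⁅⁆ (λ r'∈W → fresh ch r'∈W b-c a-r')))

  kempe-chain : ∃ λ W → v ∉ W × r₁ ∈ W × KempeClosed a b W
  kempe-chain = grow start (⊃-wellFounded ⁅ r₁ ⁆)

IsListLatinRectangle : ∀ {A : Set} {r n} → (Fin r → List A) → (Fin r → Fin n → A) → Set
IsListLatinRectangle L F =
  (∀ w → Injective _≡_ _≡_ (F w)) × (∀ i → Injective _≡_ _≡_ (λ w → F w i)) × (∀ w i → F w i ∈ˡ L w)

module ListLatinRectangle {A : Set} (_≟_ : DecidableEquality A) {r n : ℕ} (L : Fin r → List A) where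

  PartialArray : Set
  PartialArray = Fin r → Fin n → Maybe A

  _≟ₘ_ : DecidableEquality (Maybe A)
  _≟ₘ_ = ≡-decₘ _≟_

  filled : (m : Maybe A) → m ≢ nothing → ∃ λ x → m ≡ just x
  filled nothing  m≢nothing = contradiction refl m≢nothing
  filled (just x) _         = x , refl

  column : PartialArray → Fin n → Fin r → Maybe A
  column P i w = P w i

  record Admissible (P : PartialArray) : Set where
    field
      rows-injective    : ∀ {w i j x} → P w i ≡ just x → P w j ≡ just x → i ≡ j
      columns-injective : ∀ {w w' i x} → P w i ≡ just x → P w' i ≡ just x → w ≡ w'
      from-lists        : ∀ {w i x} → P w i ≡ just x → x ∈ˡ L w
  open Admissible

  empty : PartialArray
  empty _ _ = nothing

  empty-admissible : Admissible empty
  empty-admissible = record { rows-injective = λ () ; columns-injective = λ () ; from-lists = λ () }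

  hole : Maybe A → ℕ
  hole nothing  = 1
  hole (just _) = 0

  holes : PartialArray → ℕ
  holes P = sum λ w → sum λ i → hole (P w i)

  place : PartialArray → Fin r → Fin n → A → PartialArray
  place P v α s w i with w ≟ᶠ v | i ≟ᶠ α
  ... | yes _ | yes _ = just s
  ... | _     | _     = P w i

  module _ {P : PartialArray} {v : Fin r} {α : Fin n} {s : A} where

    place-here : place P v α s v α ≡ just s
    place-here with v ≟ᶠ v | α ≟ᶠ α
    ... | yes _  | yes _  = refl
    ... | no v≢v | _      = contradiction refl v≢v
    ... | yes _  | no α≢α = contradiction refl α≢α

    place-other-row : ∀ {w} i → w ≢ v → place P v α s w i ≡ P w i
    place-other-row {w} i w≢v with w ≟ᶠ v | i ≟ᶠ α
    ... | yes w≡v | yes _ = contradiction w≡v w≢v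
    ... | yes _   | no _  = refl
    ... | no _    | _     = refl

    place-other-column : ∀ {i} → i ≢ α → place P v α s v i ≡ P v i
    place-other-column {i} i≢α with v ≟ᶠ v | i ≟ᶠ α
    ... | _     | yes i≡α = contradiction i≡α i≢α
    ... | yes _ | no _    = refl
    ... | no _  | no _    = refl

    place-inversion : ∀ {w i x} → place P v α s w i ≡ just x →
                      (w ≡ v × i ≡ α × s ≡ x) ⊎ P w i ≡ just x
    place-inversion {w} {i} e with w ≟ᶠ v | i ≟ᶠ α
    ... | yes w≡v | yes i≡α = inj₁ (w≡v , i≡α , just-injective e)
    ... | yes _   | no _    = inj₂ e
    ... | no _    | _       = inj₂ e

    holes-place : P v α ≡ nothing → holes P ≡ suc (holes (place P v α s))
    holes-place hole-vα = sum-suc-at _ _ v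
      (sum-suc-at _ _ α (trans (cong hole hole-vα) (cong (suc ∘ hole) (sym place-here)))
         (λ i i≢α → cong hole (sym (place-other-column i≢α))))
      (λ w w≢v → sum-cong-≗ λ i → cong hole (sym (place-other-row i w≢v)))

    place-admissible : Admissible P → s ∈ˡ L v → (∀ i → P v i ≢ just s) → (∀ w → P w α ≢ just s) →
                       Admissible (place P v α s)
    place-admissible adm s∈L s∉row s∉column = record
      { rows-injective    = λ {w} p q → rows (place-inversion {w} p) (place-inversion {w} q)
      ; columns-injective = λ {_} {_} {i} p q → columns (place-inversion {i = i} p) (place-inversion {i = i} q)
      ; from-lists        = lists ∘ place-inversion
      }
      where
      rows : ∀ {w i j x} → (w ≡ v × i ≡ α × s ≡ x) ⊎ P w i ≡ just x →
             (w ≡ v × j ≡ α × s ≡ x) ⊎ P w j ≡ just x → i ≡ j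
      rows (inj₁ (_ , refl , _))       (inj₁ (_ , refl , _))       = refl
      rows (inj₁ (refl , _ , refl))    (inj₂ q)                    = contradiction q (s∉row _)
      rows (inj₂ p)                    (inj₁ (refl , _ , refl))    = contradiction p (s∉row _)
      rows (inj₂ p)                    (inj₂ q)                    = rows-injective adm p q
      columns : ∀ {w w' i x} → (w ≡ v × i ≡ α × s ≡ x) ⊎ P w i ≡ just x →
                (w' ≡ v × i ≡ α × s ≡ x) ⊎ P w' i ≡ just x → w ≡ w'
      columns (inj₁ (refl , _ , _))    (inj₁ (refl , _ , _))       = refl
      columns (inj₁ (_ , refl , refl)) (inj₂ q)                    = contradiction q (s∉column _)
      columns (inj₂ p)                 (inj₁ (_ , refl , refl))    = contradiction p (s∉column _)
      columns (inj₂ p)                 (inj₂ q)                    = columns-injective adm p q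
      lists : ∀ {w i x} → (w ≡ v × i ≡ α × s ≡ x) ⊎ P w i ≡ just x → x ∈ˡ L w
      lists (inj₁ (refl , _ , refl)) = s∈L
      lists (inj₂ p)                 = from-lists adm p

  swapOn : Subset r → Fin n → Fin n → Fin r → Permutation n n
  swapOn W α β w with w ∈? W
  ... | yes _ = transpose α β
  ... | no  _ = idₚ

  swapColumnsOn : Subset r → Fin n → Fin n → PartialArray → PartialArray
  swapColumnsOn W α β P w i = P w (swapOn W α β w ⟨$⟩ʳ i)

  module _ {W : Subset r} {α β : Fin n} {P : PartialArray} where

    swapped-inside : ∀ {w} i → w ∈ W → swapColumnsOn W α β P w i ≡ P w (PC.transpose α β i)
    swapped-inside {w} i w∈W with w ∈? W
    ... | yes _   = refl
    ... | no w∉W = contradiction w∈W w∉W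

    swapped-outside : ∀ {w} i → w ∉ W → swapColumnsOn W α β P w i ≡ P w i
    swapped-outside {w} i w∉W with w ∈? W
    ... | yes w∈W = contradiction w∈W w∉W
    ... | no _    = refl

    holes-swap : holes (swapColumnsOn W α β P) ≡ holes P
    holes-swap = sum-cong-≗ λ w → sym (sum-permute (λ i → hole (P w i)) (swapOn W α β w))

    swap-clears-column : ∀ {s} → (∀ w → P w β ≢ just s) → (∀ {w} → w ∉ W → P w α ≢ just s) →
                         ∀ w → swapColumnsOn W α β P w α ≢ just s
    swap-clears-column s∉β s∉α-outside w = by-membership (w ∈? W)
      where
      by-membership : Dec (w ∈ W) → swapColumnsOn W α β P w α ≢ _
      by-membership (yes w∈W) = s∉β w ∘ trans (sym (trans (swapped-inside α w∈W) (cong (P w) β-for-α)))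
        where β-for-α = transpose-matchˡ {i = α} {j = β} refl
      by-membership (no w∉W)  = s∉α-outside w∉W ∘ trans (sym (swapped-outside α w∉W))

    swap-admissible : Admissible P → KempeClosed (column P α) (column P β) W →
                      Admissible (swapColumnsOn W α β P)
    swap-admissible adm closed = record
      { rows-injective    = λ {w} p q → permutation-injective (swapOn W α β w) (rows-injective adm p q)
      ; columns-injective = columns
      ; from-lists        = from-lists adm
      }
      where
      crossing : ∀ {w w' i x} → w ∈ W → w' ∉ W → P w (PC.transpose α β i) ≡ just x → P w' i ≡ just x →
                 w ≡ w'
      crossing {w} {w'} {i} {x} w∈W w'∉W p q = by-cases (i ≟ᶠ α) (i ≟ᶠ β)
        where
        in-row-w : ∀ {k} → PC.transpose α β i ≡ k → P w k ≡ just x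
        in-row-w e = subst (λ k → P w k ≡ just x) e p
        in-row-w' : ∀ {k} → i ≡ k → P w' k ≡ just x
        in-row-w' e = subst (λ k → P w' k ≡ just x) e q
        by-cases : Dec (i ≡ α) → Dec (i ≡ β) → w ≡ w'
        by-cases (yes i≡α) _ =
          contradiction (proj₁ (closed w∈W) (in-row-w (transpose-matchˡ i≡α)) (in-row-w' i≡α)) w'∉W
        by-cases (no _) (yes i≡β) =
          contradiction (proj₂ (closed w∈W) (in-row-w (transpose-matchʳ i≡β)) (in-row-w' i≡β)) w'∉W
        by-cases (no i≢α) (no i≢β) = columns-injective adm (in-row-w (transpose-others i≢α i≢β)) q
      columns : ∀ {w w' i x} → swapColumnsOn W α β P w i ≡ just x → swapColumnsOn W α β P w' i ≡ just x →
                w ≡ w'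
      columns {w} {w'} {i} p q = by-membership (w ∈? W) (w' ∈? W)
        where
        by-membership : Dec (w ∈ W) → Dec (w' ∈ W) → w ≡ w'
        by-membership (yes w∈W) (yes w'∈W) =
          columns-injective adm (trans (sym (swapped-inside i w∈W)) p) (trans (sym (swapped-inside i w'∈W)) q)
        by-membership (no w∉W) (no w'∉W) =
          columns-injective adm (trans (sym (swapped-outside i w∉W)) p) (trans (sym (swapped-outside i w'∉W)) q)
        by-membership (yes w∈W) (no w'∉W) =
          crossing w∈W w'∉W (trans (sym (swapped-inside i w∈W)) p) (trans (sym (swapped-outside i w'∉W)) q)
        by-membership (no w∉W) (yes w'∈W) =
          sym (crossing w'∈W w∉W (trans (sym (swapped-inside i w'∈W)) q) (trans (sym (swapped-outside i w∉W)) p))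

  module _ (r≤n : r ≤ n) (L-unique : ∀ w → Unique (L w)) (L-long : ∀ w → n ≤ length (L w)) where

    free-colour : ∀ {P v α} → Admissible P → P v α ≡ nothing →
                  ∃ λ s → s ∈ˡ L v × (∀ i → P v i ≢ just s)
    free-colour {P} {v} {α} adm hole-vα with
      ∃-unmatched {R = λ k i → P v i ≡ just (lookup (L v) k)}
        (λ k i → P v i ≟ₘ just (lookup (L v) k))
        (λ p q → lookup-injective (L-unique v) (just-injective (trans (sym p) q)))
        α (λ k p → case trans (sym hole-vα) p of λ ()) (L-long v)
    ... | k , unmatched = lookup (L v) k , ∈-lookup k , unmatched

    free-column : ∀ {P v s} → Admissible P → (∀ i → P v i ≢ just s) → ∃ λ β → ∀ w → P w β ≢ just s
    free-column {P} {v} {s} adm s∉row =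
      ∃-unmatched {R = λ i w → P w i ≡ just s} (λ i w → P w i ≟ₘ just s)
        (rows-injective adm) v s∉row r≤n

    separating-set : ∀ {P v α β s} → Admissible P → P v α ≡ nothing → (∀ w → P w β ≢ just s) →
                     ∃ λ W → v ∉ W × KempeClosed (column P α) (column P β) W ×
                             (∀ {w} → w ∉ W → P w α ≢ just s)
    separating-set {P} {v} {α} {β} {s} adm hole-vα s∉β with any? (λ w → P w α ≟ₘ just s)
    ... | no s∉α = ∅ , ∉⊥ , (λ w∈∅ → contradiction w∈∅ ∉⊥) , λ _ s-at-w → s∉α (_ , s-at-w)
    ... | yes (r₁ , s-at-r₁) =
      let W , v∉W , r₁∈W , closed = KempeChain.kempe-chain _≟_ (column P α) (column P β)
                                      (columns-injective adm) (columns-injective adm)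
                                      (λ p q → α≢β (rows-injective adm p q)) s∉β hole-vα s-at-r₁
      in W , v∉W , closed , λ w∉W s-at-w → w∉W (subst (_∈ W) (columns-injective adm s-at-r₁ s-at-w) r₁∈W)
      where
      α≢β : α ≢ β
      α≢β refl = s∉β r₁ s-at-r₁

    fill-hole : ∀ {P v α} → Admissible P → P v α ≡ nothing →
                ∃ λ P' → Admissible P' × holes P ≡ suc (holes P')
    fill-hole {P} {v} {α} adm hole-vα =
      let s , s∈L , s∉row                = free-colour adm hole-vα
          β , s∉β                        = free-column adm s∉row
          W , v∉W , closed , s∉α-outside = separating-set adm hole-vα s∉β
          Q-row-v : ∀ i → swapColumnsOn W α β P v i ≡ P v i
          Q-row-v i = swapped-outside {W} {α} {β} {P} i v∉W
      in place (swapColumnsOn W α β P) v α s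
       , place-admissible (swap-admissible {W} {α} {β} {P} adm closed) s∈L
           (λ i → s∉row i ∘ trans (sym (Q-row-v i))) (swap-clears-column {W} {α} {β} {P} s∉β s∉α-outside)
       , trans (sym (holes-swap {W} {α} {β} {P})) (holes-place (trans (Q-row-v α) hole-vα))

    complete : ∀ {P} → Admissible P → Acc _<_ (holes P) → ∃ (IsListLatinRectangle L)
    complete {P} adm (acc smaller) with any? (λ w → any? (λ i → P w i ≟ₘ nothing))
    ... | yes (v , α , hole-vα) =
      let P' , adm' , fewer = fill-hole adm hole-vα
      in complete adm' (smaller (≤-reflexive (sym fewer)))
    ... | no no-hole =
      F , (λ w {i} {j} e → rows-injective adm (entry w i) (trans (entry w j) (cong just (sym e))))
        , (λ i {w} {w'} e → columns-injective adm (entry w i) (trans (entry w' i) (cong just (sym e))))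
        , (λ w i → from-lists adm (entry w i))
      where
      full : ∀ w i → ∃ λ x → P w i ≡ just x
      full w i = filled (P w i) (λ hole-wi → no-hole (w , i , hole-wi))
      F : Fin r → Fin n → A
      F w i = proj₁ (full w i)
      entry : ∀ w i → P w i ≡ just (F w i)
      entry w i = proj₂ (full w i)

    list-Latin-rectangle : ∃ (IsListLatinRectangle L)
    list-Latin-rectangle = complete empty-admissible (<-wellFounded _)

open ListLatinRectangle using (list-Latin-rectangle)

packing-upper-bound : ∀ n → PackingProperty (K n) n
packing-upper-bound n L L-n
  with list-Latin-rectangle _≟ℕ_ L ≤-refl (proj₁ ∘ L-n) (≤-reflexive ∘ sym ∘ proj₂ ∘ L-n)
... | F , rows-injective , columns-injective , from-lists =
  (λ i v → F v i) ,
  (λ i → (λ v → from-lists v i) , λ u v u≢v → u≢v ∘ columns-injective i) ,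
  (λ i j i≢j v → i≢j ∘ rows-injective v)

K-proper⇒injective : ∀ {n} {f : Fin n → ℕ} → IsProper (K n) f → Injective _≡_ _≡_ f
K-proper⇒injective {f = f} proper {u} {v} fu≡fv with u ≟ᶠ v
... | yes u≡v = u≡v
... | no u≢v  = contradiction fu≡fv (proper u v u≢v)

bounded-injective⇒≤ : ∀ {n j} (f : Fin n → ℕ) → Injective _≡_ _≡_ f → (f<j : ∀ v → f v < j) → n ≤ j
bounded-injective⇒≤ f f-injective f<j = injective⇒≤ {f = λ v → fromℕ< (f<j v)} λ e →
  f-injective (trans (sym (toℕ-fromℕ< _)) (trans (cong toℕ e) (toℕ-fromℕ< _)))

packing-lower-bound : ∀ n j → 1 ≤ j → PackingProperty (K n) j → n ≤ j
packing-lower-bound n (suc j) _ packing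
  with packing (λ _ → upTo (suc j)) (λ _ → upTo⁺ (suc j) , length-upTo (suc j))
... | f , colourings , _ =
  bounded-injective⇒≤ (f zero) (K-proper⇒injective (proj₂ (colourings zero))) (∈-upTo⁻ ∘ proj₁ (colourings zero))

theorem3 : (n : ℕ) → 1 ≤ n → ListPackingNumber≡ (K n) n
theorem3 n 1≤n = 1≤n , packing-upper-bound n , packing-lower-bound n
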